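{- For every $d\ge2$, the set of P-positions of the grandiose rat game $\mathcal{M}$ on $d$ heaps is exactly $\mathcal{R}$, i.e. $P(\mathcal{M})=\mathcal{R}$.
   Context: $\mathbb{N}=\{1,2,\ldots\}$, $\mathbb{N}_0=\mathbb{N}\cup\{0\}$. Fix $d\ge2$. For $n\in\mathbb{N}$ and $i\in\{1,\ldots,d\}$ let $r_i(n)=\left\lfloor \frac{(2^d-1)n}{2^{d-i}}\right\rfloor-2^{i-1}+1$ and $\mathbf{r}(n)=(r_1(n),\ldots,r_d(n))$. Let $\mathcal{R}=\{\mathbf{r}(n):n\in\mathbb{N}\}\cup\{\mathbf{0}\}$ and $\mathcal{R}-\mathcal{R}=\{\mathbf{r}-\mathbf{s}:\mathbf{r},\mathbf{s}\in\mathcal{R}\}$. The grandiose rat game is the vector subtraction game with move set $\mathcal{M}=\mathbb{N}_0^d\setminus(\mathcal{R}-\mathcal{R})$: positions are $\mathbf{x}\in\mathbb{N}_0^d$, and from $\mathbf{x}$ a player may move to $\mathbf{y}\in\mathbb{N}_0^d$ iff $\mathbf{x}-\mathbf{y}\in\mathcal{M}$. Two players alternate moves; under normal play a player unable to move loses. $P(\mathcal{M})$ is the set of positions from which the previous player (the one who just moved) wins with optimal play. -}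

module Defs where

open import Data.Nat using (ℕ; zero; suc; _+_; _*_; _∸_; _^_; _≤_; _<_; _/_)
open import Data.Nat.Properties using (m^n≢0)
open import Data.Fin using (Fin; toℕ)
open import Data.Product using (Σ; _×_; _,_; ∃)
open import Data.Sum using (_⊎_)
open import Relation.Binary.PropositionalEquality using (_≡_)
open import Relation.Nullary using (¬_)

Pos : ℕ → Set
Pos d = Fin d → ℕ

div2^ : ℕ → ℕ → ℕ
div2^ a k = _/_ a (2 ^ k) {{m^n≢0 2 k}}

-- r_i(n) = ⌊(2^d-1) n / 2^(d-i)⌋ - 2^(i-1) + 1, with i = toℕ j + 1.
-- (For n ≥ 1 the value is ≥ 0, so truncated subtraction after adding 1 is exact.)
rcoord : (d : ℕ) → ℕ → Fin d → ℕ
rcoord d n j = div2^ ((2 ^ d ∸ 1) * n) (d ∸ suc (toℕ j)) + 1 ∸ 2 ^ toℕ j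

InR : (d : ℕ) → Pos d → Set
InR d x = (∀ j → x j ≡ 0) ⊎ Σ ℕ (λ n → (1 ≤ n) × (∀ j → x j ≡ rcoord d n j))

InRminusR : (d : ℕ) → Pos d → Set
InRminusR d m = Σ (Pos d) (λ r → Σ (Pos d) (λ s →
  InR d r × InR d s × (∀ j → m j + s j ≡ r j)))

InM : (d : ℕ) → Pos d → Set
InM d m = ¬ InRminusR d m

Move : (d : ℕ) → Pos d → Pos d → Set
Move d x y = (∀ j → y j ≤ x j) × InM d (λ j → x j ∸ y j)

data IsP (d : ℕ) (x : Pos d) : Set
data IsN (d : ℕ) (x : Pos d) : Set

data IsP d x where
  allN : (∀ y → Move d x y → IsN d y) → IsP d x

data IsN d x where
  someP : (y : Pos d) → Move d x y → IsP d y → IsN d x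

-- 𝓡 is independent, since a move between two of its points would be a difference in 𝓡 − 𝓡,
-- and absorbing.  From y ∉ 𝓡 the move to 𝟎 is legal unless y ∈ 𝓡 − 𝓡, i.e. y = 𝐫(n) − 𝐫(m)
-- with m < n; then y ≥ 𝐫(1), because each coordinate of 𝐫 is superadditive in n, and the last
-- coordinate of y is divisible by c = 2^d − 1.  In that case the move to 𝐫(1) is legal: the last
-- coordinates of 𝓡 are 0 and a + kc with a = 2^(d−1), so those of 𝓡 − 𝓡 are ≡ 0 or a (mod c),
-- whereas y − 𝐫(1) has last coordinate ≡ −a, and c divides neither a nor 2a = c + 1.
-- Since every move decreases the total heap size, an independent absorbing set is the set of
-- P-positions.

module Submission where

open import Defs
open import Data.Nat using (ℕ; zero; suc; _+_; _*_; _∸_; _^_; _≤_; _<_; _/_; z≤n; s≤s; s≤s⁻¹; NonZero; >-nonZero; _≟_; _≤?_; _<?_)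
open import Data.Nat.Properties
open import Data.Nat.DivMod using (m*n/n≡m; m/n*n≤m; /-monoˡ-≤; n/1≡n)
open import Data.Nat.Divisibility using (_∣_; _∣?_; _∣0; ∣⇒≤; ∣1⇒≡1; ∣m+n∣m⇒∣n; n∣m*n)
open import Data.Nat.Induction using (<-wellFounded)
open import Data.Nat.Tactic.RingSolver using (solve-∀)
open import Data.Fin using (Fin; toℕ; fromℕ)
open import Data.Fin.Properties using (toℕ-fromℕ; toℕ<n; all?; ¬∀⟶∃¬)
open import Data.Product using (Σ; ∃; _×_; _,_)
open import Data.Sum using (_⊎_; inj₁; inj₂; [_,_]′)
open import Data.Empty using (⊥-elim)
open import Function using (case_of_; _∘′_)
open import Function.Bundles using (_⇔_; mk⇔)
open import Induction.WellFounded using (Acc; acc)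
open import Relation.Nullary using (¬_; Dec; yes; no)
open import Relation.Nullary.Decidable using (_×-dec_; _⊎-dec_; map′)
open import Relation.Binary.PropositionalEquality

m*n≤o⇒m≤o/n : ∀ m n {o} .{{_ : NonZero n}} → m * n ≤ o → m ≤ o / n
m*n≤o⇒m≤o/n m n le = subst (_≤ _) (m*n/n≡m m n) (/-monoˡ-≤ n le)

m/o+n/o≤[m+n]/o : ∀ m n o .{{_ : NonZero o}} → m / o + n / o ≤ (m + n) / o
m/o+n/o≤[m+n]/o m n o = m*n≤o⇒m≤o/n (m / o + n / o) o (begin
  (m / o + n / o) * o    ≡⟨ *-distribʳ-+ o (m / o) (n / o) ⟩
  m / o * o + n / o * o  ≤⟨ +-mono-≤ (m/n*n≤m m o) (m/n*n≤m n o) ⟩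
  m + n                  ∎)
  where open ≤-Reasoning

[m+1∸p]+[n+1∸p]≤m+n+1∸p : ∀ m n {p} → 1 ≤ p → p ≤ m →
                          (m + 1 ∸ p) + (n + 1 ∸ p) ≤ m + n + 1 ∸ p
[m+1∸p]+[n+1∸p]≤m+n+1∸p m n {p} 1≤p p≤m = begin
  (m + 1 ∸ p) + (n + 1 ∸ p)  ≤⟨ +-monoʳ-≤ (m + 1 ∸ p) (∸-monoʳ-≤ (n + 1) 1≤p) ⟩
  (m + 1 ∸ p) + (n + 1 ∸ 1)  ≡⟨ cong ((m + 1 ∸ p) +_) (m+n∸n≡m n 1) ⟩
  (m + 1 ∸ p) + n            ≡⟨ +-∸-comm n (≤-trans p≤m (m≤m+n m 1)) ⟨
  m + 1 + n ∸ p              ≡⟨ cong (_∸ p) (swap-1 m n) ⟩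
  m + n + 1 ∸ p              ∎
  where
  open ≤-Reasoning
  swap-1 : ∀ m n → m + 1 + n ≡ m + n + 1
  swap-1 = solve-∀

2^n≤2^[1+n]∸1 : ∀ n → 2 ^ n ≤ 2 ^ suc n ∸ 1
2^n≤2^[1+n]∸1 n = m+n≤o⇒m≤o∸n (2 ^ n) (+-monoʳ-≤ (2 ^ n) (≤-trans (m^n>0 2 n) (m≤m+n (2 ^ n) 0)))

∑ : ∀ {n} → (Fin n → ℕ) → ℕ
∑ {zero}  f = 0
∑ {suc n} f = f Fin.zero + ∑ (λ j → f (Fin.suc j))

∑-mono-≤ : ∀ {n} {f g : Fin n → ℕ} → (∀ j → f j ≤ g j) → ∑ f ≤ ∑ g
∑-mono-≤ {zero}  le = z≤n
∑-mono-≤ {suc n} le = +-mono-≤ (le Fin.zero) (∑-mono-≤ (λ j → le (Fin.suc j)))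

∑-mono-< : ∀ {n} {f g : Fin n → ℕ} → (∀ j → f j ≤ g j) → ∃ (λ j → f j < g j) → ∑ f < ∑ g
∑-mono-< le (Fin.zero  , lt) = +-mono-<-≤ lt (∑-mono-≤ (λ j → le (Fin.suc j)))
∑-mono-< le (Fin.suc i , lt) = +-mono-≤-< (le Fin.zero) (∑-mono-< (λ j → le (Fin.suc j)) (i , lt))

module _ {d : ℕ} where

  0∈R : InR d (λ _ → 0)
  0∈R = inj₁ (λ _ → refl)

  0∈R-R : ∀ {w} → (∀ j → w j ≡ 0) → InRminusR d w
  0∈R-R w≡0 = _ , _ , 0∈R , 0∈R , λ j → trans (+-identityʳ _) (w≡0 j)

  move-decreases-∑ : ∀ {x y} → Move d x y → ∑ y < ∑ x
  move-decreases-∑ {x} {y} (y≤x , x-y∉R-R) =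
    let j , x-y≢0 = ¬∀⟶∃¬ d _ (λ j → x j ∸ y j ≟ 0) (x-y∉R-R ∘′ 0∈R-R)
    in ∑-mono-< y≤x (j , m∸n≢0⇒n<m x-y≢0)

  R-independent : ∀ {x y} → InR d x → InR d y → ¬ Move d x y
  R-independent {x} {y} Rx Ry (y≤x , x-y∉R-R) = x-y∉R-R (x , y , Rx , Ry , λ j → m∸n+n≡m (y≤x j))

  IsP⇒¬IsN : ∀ {x} → IsP d x → ¬ IsN d x
  IsP⇒¬IsN (allN N) (someP y x→y Py) = IsP⇒¬IsN Py (N y x→y)

Absorbing : ℕ → Set
Absorbing d = ∀ x → InR d x ⊎ Σ (Pos d) (λ r → InR d r × Move d x r)

module _ {d : ℕ} (absorbing : Absorbing d) where

  InR⇒IsP : ∀ {x} → InR d x → IsP d x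
  InR⇒IsP {x} = go x (<-wellFounded (∑ x))
    where
    go : ∀ x → Acc _<_ (∑ x) → InR d x → IsP d x
    go x (acc rec) Rx = allN λ y x→y → case absorbing y of λ where
      (inj₁ Ry) → ⊥-elim (R-independent Rx Ry x→y)
      (inj₂ (r , Rr , y→r)) → someP r y→r
        (go r (rec (<-trans (move-decreases-∑ y→r) (move-decreases-∑ x→y))) Rr)

  IsP⇒InR : ∀ {x} → IsP d x → InR d x
  IsP⇒InR {x} Px with absorbing x
  ... | inj₁ Rx = Rx
  ... | inj₂ (r , Rr , x→r) = ⊥-elim (IsP⇒¬IsN Px (someP r x→r (InR⇒IsP Rr)))

  absorbing⇒IsP⇔InR : ∀ x → IsP d x ⇔ InR d x
  absorbing⇒IsP⇔InR x = mk⇔ IsP⇒InR InR⇒IsP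

rcoord-mono : ∀ {d} (j : Fin d) {m n} → m ≤ n → rcoord d m j ≤ rcoord d n j
rcoord-mono {d} j m≤n = ∸-monoˡ-≤ (2 ^ toℕ j)
  (+-monoˡ-≤ 1 (/-monoˡ-≤ (2 ^ e) {{m^n≢0 2 e}} (*-monoʳ-≤ (2 ^ d ∸ 1) m≤n)))
  where
  e : ℕ
  e = d ∸ suc (toℕ j)

rcoord-superadditive : ∀ {d} (j : Fin d) {k} m → 1 ≤ k →
                       rcoord d k j + rcoord d m j ≤ rcoord d (k + m) j
rcoord-superadditive {suc D} j {k} m 1≤k = ≤-trans
  ([m+1∸p]+[n+1∸p]≤m+n+1∸p (F k) (F m) (m^n>0 2 i) 2^i≤Fk)
  (∸-monoˡ-≤ (2 ^ i) (+-monoˡ-≤ 1 Fk+Fm≤F[k+m]))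
  where
  i c q : ℕ
  i = toℕ j
  c = 2 ^ suc D ∸ 1
  q = 2 ^ (D ∸ i)
  instance q≢0 : NonZero q
  q≢0 = m^n≢0 2 (D ∸ i)
  -- rcoord (suc D) x j unfolds to F x + 1 ∸ 2 ^ i.
  F : ℕ → ℕ
  F x = (c * x) / q
  2^i*q≡2^D : 2 ^ i * q ≡ 2 ^ D
  2^i*q≡2^D = trans (sym (^-distribˡ-+-* 2 i (D ∸ i))) (cong (2 ^_) (m+[n∸m]≡n (s≤s⁻¹ (toℕ<n j))))
  2^i≤Fk : 2 ^ i ≤ F k
  2^i≤Fk = m*n≤o⇒m≤o/n (2 ^ i) q
    (≤-trans (≤-reflexive 2^i*q≡2^D) (≤-trans (2^n≤2^[1+n]∸1 D) (m≤m*n c k {{>-nonZero 1≤k}})))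
  Fk+Fm≤F[k+m] : F k + F m ≤ F (k + m)
  Fk+Fm≤F[k+m] = ≤-trans (m/o+n/o≤[m+n]/o (c * k) (c * m) q) (≤-reflexive (cong (_/ q) (sym (*-distribˡ-+ c k m))))

module LastCoordinate (D : ℕ) where

  ℓ : Fin (suc D)
  ℓ = fromℕ D

  a c : ℕ
  a = 2 ^ D
  c = 2 ^ suc D ∸ 1

  c+1≡a+a : c + 1 ≡ a + a
  c+1≡a+a = trans (m∸n+n≡m (≤-trans (m^n>0 2 D) (m≤m+n a (a + 0)))) (cong (a +_) (+-identityʳ a))

  instance c≢0 : NonZero c
  c≢0 = >-nonZero (+-cancelʳ-≤ 1 1 c (≤-trans (+-mono-≤ (m^n>0 2 D) (m^n>0 2 D)) (≤-reflexive (sym c+1≡a+a))))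

  rcoord-last : ∀ m → rcoord (suc D) (suc m) ℓ ≡ a + m * c
  rcoord-last m = begin
    rcoord (suc D) (suc m) ℓ           ≡⟨ cong (λ i → div2^ (c * suc m) (D ∸ i) + 1 ∸ 2 ^ i) (toℕ-fromℕ D) ⟩
    div2^ (c * suc m) (D ∸ D) + 1 ∸ a  ≡⟨ cong (λ k → div2^ (c * suc m) k + 1 ∸ a) (n∸n≡0 D) ⟩
    c * suc m / 1 + 1 ∸ a              ≡⟨ cong (λ x → x + 1 ∸ a) (n/1≡n (c * suc m)) ⟩
    c * suc m + 1 ∸ a                  ≡⟨ cong (_∸ a) (shift c m) ⟩
    (c + 1) + m * c ∸ a                ≡⟨ cong (λ x → x + m * c ∸ a) c+1≡a+a ⟩
    (a + a) + m * c ∸ a                ≡⟨ cong (_∸ a) (+-assoc a a (m * c)) ⟩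
    a + (a + m * c) ∸ a                ≡⟨ m+n∸m≡n a (a + m * c) ⟩
    a + m * c                          ∎
    where
    open ≡-Reasoning
    shift : ∀ c m → c * suc m + 1 ≡ (c + 1) + m * c
    shift = solve-∀

  n≤rcoord-last : ∀ n → 1 ≤ n → n ≤ rcoord (suc D) n ℓ
  n≤rcoord-last (suc m) _ = subst (suc m ≤_) (sym (rcoord-last m))
    (+-mono-≤ (m^n>0 2 D) (m≤m*n m c))

  InR? : ∀ y → Dec (InR (suc D) y)
  InR? y = all? (λ j → y j ≟ 0) ⊎-dec map′ forget-bound add-bound (anyUpTo? r? (suc (y ℓ)))
    where
    Rn : ℕ → Set
    Rn n = 1 ≤ n × (∀ j → y j ≡ rcoord (suc D) n j)
    r? : ∀ n → Dec (Rn n)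
    r? n = 1 ≤? n ×-dec all? (λ j → y j ≟ rcoord (suc D) n j)
    forget-bound : ∃ (λ n → n < suc (y ℓ) × Rn n) → Σ ℕ Rn
    forget-bound (n , _ , Rn) = n , Rn
    add-bound : Σ ℕ Rn → ∃ (λ n → n < suc (y ℓ) × Rn n)
    add-bound (n , 1≤n , y≡r) = n , s≤s (subst (n ≤_) (sym (y≡r ℓ)) (n≤rcoord-last n 1≤n)) , 1≤n , y≡r

module RatGame (e : ℕ) where

  d : ℕ
  d = suc (suc e)

  open LastCoordinate (suc e)

  r : ℕ → Pos d
  r n = rcoord d n

  a≥2 : 2 ≤ a
  a≥2 = *-monoʳ-≤ 2 (m^n>0 2 e)

  a<c : a < c
  a<c = +-cancelʳ-< 1 a c (subst (a + 1 <_) (sym c+1≡a+a) (+-monoʳ-< a a≥2))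

  c≢1 : c ≢ 1
  c≢1 c≡1 = <⇒≱ a<c (subst (_≤ a) (sym c≡1) (≤-trans (s≤s z≤n) a≥2))

  r₁-last : r 1 ℓ ≡ a
  r₁-last = trans (rcoord-last 0) (+-identityʳ a)

  ∣-rcoord-last-difference : ∀ {w m n} → 1 ≤ m → 1 ≤ n → w + r m ℓ ≡ r n ℓ → c ∣ w
  ∣-rcoord-last-difference {w} {suc m} {suc n} _ _ eq = ∣m+n∣m⇒∣n (subst (c ∣_) (sym w+m*c≡n*c) (n∣m*n n)) (n∣m*n m)
    where
    w+m*c≡n*c : m * c + w ≡ n * c
    w+m*c≡n*c = +-cancelˡ-≡ a _ _ (begin
      a + (m * c + w)  ≡⟨ rearrange a (m * c) w ⟩
      w + (a + m * c)  ≡⟨ cong (w +_) (rcoord-last m) ⟨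
      w + r (suc m) ℓ  ≡⟨ eq ⟩
      r (suc n) ℓ      ≡⟨ rcoord-last n ⟩
      a + n * c        ∎)
      where
      open ≡-Reasoning
      rearrange : ∀ a x w → a + (x + w) ≡ w + (a + x)
      rearrange = solve-∀

  InR-resp-≗ : ∀ {x y} → (∀ j → x j ≡ y j) → InR d x → InR d y
  InR-resp-≗ x≗y (inj₁ x≡0)             = inj₁ (λ j → trans (sym (x≗y j)) (x≡0 j))
  InR-resp-≗ x≗y (inj₂ (n , 1≤n , x≡r)) = inj₂ (n , 1≤n , λ j → trans (sym (x≗y j)) (x≡r j))

  MovableTo-r₁ : Pos d → Set
  MovableTo-r₁ y = (∀ j → r 1 j ≤ y j) × c ∣ y ℓ

  r-difference⇒InR⊎MovableTo-r₁ : ∀ {y m n} → 1 ≤ m → 1 ≤ n → (∀ j → y j + r m j ≡ r n j) →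
                                  InR d y ⊎ MovableTo-r₁ y
  r-difference⇒InR⊎MovableTo-r₁ {y} {m} {n} 1≤m 1≤n y+rm≡rn with m <? n
  ... | yes m<n = inj₂ (r₁≤y , ∣-rcoord-last-difference 1≤m 1≤n (y+rm≡rn ℓ))
    where
    r₁≤y : ∀ j → r 1 j ≤ y j
    r₁≤y j = +-cancelʳ-≤ (r m j) (r 1 j) (y j) (begin
      r 1 j + r m j  ≤⟨ rcoord-superadditive j m ≤-refl ⟩
      r (1 + m) j    ≤⟨ rcoord-mono j m<n ⟩
      r n j          ≡⟨ y+rm≡rn j ⟨
      y j + r m j    ∎)
      where open ≤-Reasoning
  ... | no m≮n = inj₁ (inj₁ (λ j → n≤0⇒n≡0 (+-cancelʳ-≤ (r m j) (y j) 0
                   (≤-trans (≤-reflexive (y+rm≡rn j)) (rcoord-mono j (≮⇒≥ m≮n))))))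

  R-R⇒InR⊎MovableTo-r₁ : ∀ {y} → InRminusR d y → InR d y ⊎ MovableTo-r₁ y
  R-R⇒InR⊎MovableTo-r₁ {y} (_ , _ , Rx , inj₁ s≡0 , y+s≡x) =
    inj₁ (InR-resp-≗ (λ j → trans (sym (y+s≡x j)) (trans (cong (y j +_) (s≡0 j)) (+-identityʳ (y j)))) Rx)
  R-R⇒InR⊎MovableTo-r₁ {y} (_ , _ , inj₁ x≡0 , inj₂ _ , y+s≡x) =
    inj₁ (inj₁ (λ j → m+n≡0⇒m≡0 (y j) (trans (y+s≡x j) (x≡0 j))))
  R-R⇒InR⊎MovableTo-r₁ {y} (_ , _ , inj₂ (n , 1≤n , x≡rn) , inj₂ (m , 1≤m , s≡rm) , y+s≡x) =
    r-difference⇒InR⊎MovableTo-r₁ 1≤m 1≤n (λ j → trans (cong (y j +_) (sym (s≡rm j))) (trans (y+s≡x j) (x≡rn j)))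

  last-residue-of-R-R : ∀ {w} → InRminusR d w → c ∣ w ℓ ⊎ ∃ (λ k → w ℓ ≡ a + k * c)
  last-residue-of-R-R {w} (_ , _ , inj₁ x≡0 , _ , w+s≡x) =
    inj₁ (subst (c ∣_) (sym (m+n≡0⇒m≡0 (w ℓ) (trans (w+s≡x ℓ) (x≡0 ℓ)))) (c ∣0))
  last-residue-of-R-R {w} (_ , _ , inj₂ (zero , () , _) , inj₁ _ , _)
  last-residue-of-R-R {w} (x , s , inj₂ (suc k , _ , x≡r) , inj₁ s≡0 , w+s≡x) = inj₂ (k , (begin
    w ℓ          ≡⟨ +-identityʳ (w ℓ) ⟨
    w ℓ + 0      ≡⟨ cong (w ℓ +_) (s≡0 ℓ) ⟨
    w ℓ + s ℓ    ≡⟨ w+s≡x ℓ ⟩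
    x ℓ          ≡⟨ x≡r ℓ ⟩
    r (suc k) ℓ  ≡⟨ rcoord-last k ⟩
    a + k * c    ∎))
    where open ≡-Reasoning
  last-residue-of-R-R {w} (_ , _ , inj₂ (n , 1≤n , x≡rn) , inj₂ (m , 1≤m , s≡rm) , w+s≡x) =
    inj₁ (∣-rcoord-last-difference 1≤m 1≤n (trans (cong (w ℓ +_) (sym (s≡rm ℓ))) (trans (w+s≡x ℓ) (x≡rn ℓ))))

  r₁-move : ∀ {y} → MovableTo-r₁ y → Move d y (r 1)
  r₁-move {y} (r₁≤y , c∣y) = r₁≤y , λ z∈R-R → case last-residue-of-R-R z∈R-R of λ where
      (inj₁ c∣z) → <⇒≱ a<c (∣⇒≤ {{m^n≢0 2 (suc e)}} (∣m+n∣m⇒∣n c∣z+a c∣z))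
      (inj₂ (k , z≡a+kc)) → c≢1 (∣1⇒≡1 (∣m+n∣m⇒∣n (subst (c ∣_) (z+a≡[1+k]c+1 {k} z≡a+kc) c∣z+a) (n∣m*n (suc k))))
    where
    z : ℕ
    z = y ℓ ∸ r 1 ℓ
    z+a≡y : z + a ≡ y ℓ
    z+a≡y = trans (cong (z +_) (sym r₁-last)) (m∸n+n≡m (r₁≤y ℓ))
    c∣z+a : c ∣ z + a
    c∣z+a = subst (c ∣_) (sym z+a≡y) c∣y
    z+a≡[1+k]c+1 : ∀ {k} → z ≡ a + k * c → z + a ≡ suc k * c + 1
    z+a≡[1+k]c+1 {k} z≡a+kc = begin
      z + a              ≡⟨ cong (_+ a) z≡a+kc ⟩
      a + k * c + a      ≡⟨ regroup a (k * c) ⟩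
      (a + a) + k * c    ≡⟨ cong (_+ k * c) c+1≡a+a ⟨
      (c + 1) + k * c    ≡⟨ regroup′ c (k * c) ⟩
      suc k * c + 1      ∎
      where
      open ≡-Reasoning
      regroup : ∀ a x → a + x + a ≡ (a + a) + x
      regroup = solve-∀
      regroup′ : ∀ c x → (c + 1) + x ≡ (c + x) + 1
      regroup′ = solve-∀

  absorbing : Absorbing d
  absorbing y with all? (λ j → r 1 j ≤? y j) ×-dec c ∣? y ℓ
  ... | yes y→r₁ = inj₂ (r 1 , inj₂ (1 , ≤-refl , λ _ → refl) , r₁-move y→r₁)
  ... | no ¬y→r₁ with InR? y
  ...   | yes Ry = inj₁ Ry
  ...   | no ¬Ry = inj₂ ((λ _ → 0) , 0∈R , (λ _ → z≤n) , [ ¬Ry , ¬y→r₁ ]′ ∘′ R-R⇒InR⊎MovableTo-r₁)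

theorem3 : (d : ℕ) → 2 ≤ d → (x : Pos d) → IsP d x ⇔ InR d x
theorem3 (suc (suc e)) (s≤s (s≤s z≤n)) = absorbing⇒IsP⇔InR (RatGame.absorbing e)
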